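{- Let $m\ge1$ and let $\Lambda=(0,0,\dots,0;\lambda)$ be an $m$-partition whose non-symmetric part is zero. Then $s^*_\Lambda(x;t)=k_\Lambda(x;t)=s_\lambda(x)$, where $s_\lambda(x)$ is the Schur function in all the variables $x_1,x_2,\dots$.
   Context: $q,t$ indeterminates; $R_m=\mathbb Q(q,t)[x_1,\dots,x_m]\otimes\mathbf\Lambda_m$, $\mathbf\Lambda_m$ the symmetric functions in $x_{m+1},x_{m+2},\dots$. An $m$-partition is $\Lambda=(\pmb a;\lambda)$, $\pmb a\in\mathbb Z_{\ge0}^m$, $\lambda$ a partition; $\Omega=(\pmb b;\mu)$ denotes another one; $|\Lambda|=|\pmb a|+|\lambda|$; $\Lambda$ is dominant if $a_1\ge\dots\ge a_m$; $s_i\Lambda=((a_1,\dots,a_{i+1},a_i,\dots,a_m);\lambda)$; $\pmb a\cup\lambda$ is the decreasing rearrangement of all entries of $\pmb a$ and $\lambda$. Hecke operators on $R_m$: $T_i=t+\frac{tx_i-x_{i+1}}{x_i-x_{i+1}}(K_{i,i+1}-1)$, $1\le i\le m-1$. $H_{\pmb a}(x_1,\dots,x_m;t)$ is the non-symmetric Hall–Littlewood polynomial (the non-symmetric Macdonald polynomial $E_{\pmb a}(x_1,\dots,x_m;q,t)$ at $q=0$); $H_{\pmb a}=x^{\pmb a}$ when $\pmb a$ is dominant and $H_{s_i\pmb a}=T_iH_{\pmb a}$ when $a_i>a_{i+1}$. $k_\Lambda(x;t)=H_{\pmb a}(x_1,\dots,x_m;t)\,s_\lambda(x_1,x_2,\dots)$;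 these form a basis of $R_m$. $\langle\cdot,\cdot\rangle_m$ is the bilinear form with $\langle k_\Lambda,k_\Omega\rangle_m=\delta_{\Lambda\Omega}$, and $T_i^*$ is the adjoint of $T_i$. Words and charge. Action of the symmetric group on words in letters $1,2,\dots$: for a word $w$ and $i\ge1$, in the subword of letters $i,i+1$ bracket every letter $i+1$ immediately followed (in that subword) by a letter $i$, delete bracketed pairs and repeat until the unbracketed letters read $i^r(i+1)^s$; $\sigma_i(w)$ replaces these by $i^s(i+1)^r$ in the same positions. Charge of a word $w$ with weakly decreasing evaluation: in one pass, start with counter $\ell=0$ at the right end, scan leftwards, label the first unlabeled $1$ met with $\ell$, continue leftwards to the first unlabeled $2$ and label it $\ell$, then $3$, etc.; whenever the scan passes the left end it resumes at the right end and $\ell$ increases by $1$; the pass ends after labeling the largest letter $k$ such that $1,\dots,k$ all had unlabeled occurrences at the start of the pass. Repeat on unlabeled letters until all are labeled; charge$(w)$ is the sum of labels. For general $w$, charge$(w)$=charge$(\sigma(w))$ for any $\sigma$ with $\sigma(w)$ of weakly decreasing evaluation. The charge of a word in letters $\bar1,\dots,\bar m$ is that of the word obtained by replacing each $\bar i$ by $m+1-i$. Tableaux. A skew tableau is a filling of a skew diagram weakly increasing along rows and strictly increasing down columns; its reading word $w(T)$ reads rows from bottom to top, left to right. For dominant $\Lambda$ and $|\Omega|=|\Lambda|$, $\mathcal S_{\Lambda\Omega}$ is the set of skew tableaux of shape $(\pmb a\cup\lambda)/\mu$ in letters $1<\dots<m$ with letter $i$ appearing $b_i$ times, all in columns $1,\dots,a_i$.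 For $T\in\mathcal S_{\Lambda\Omega}$, $\bar T$ is the filling of $\mu/\lambda$ whose column $c$ consists of the letters $\bar i$, for those $i$ with $c\le a_i$ such that column $c$ of $T$ has no $i$, placed with indices decreasing from top to bottom. $u_{\pmb a}=\bar2^{a_1-a_2}\cdots\bar m^{a_1-a_m}$, ${\rm Inv}(\pmb b)=\#\{i<j:b_i<b_j\}$, ${\rm charge}_{\pmb a,\pmb b}(T)={\rm Inv}(\pmb b)+{\rm charge}(w(\bar T)u_{\pmb a})$. Dual $m$-symmetric Schur functions: for dominant $\Lambda$, $s^*_\Lambda(x;t)=\sum_\Omega D_{\Lambda\Omega}(t)k_\Omega(x;t)$ with $D_{\Lambda\Omega}(t)=\sum_{T\in\mathcal S_{\Lambda\Omega}}t^{{\rm charge}_{\pmb a,\pmb b}(T)}$; if $a_i<a_{i+1}$, $s^*_\Lambda=t^{ -1}T_i^*s^*_{s_i\Lambda}$ (recursively). -}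

module Defs where

open import Data.Nat using (ℕ; zero; suc; _+_; _*_; _∸_; _≤_; _≡ᵇ_; _<ᵇ_; _≤ᵇ_; _⊔_)
open import Data.Bool using (Bool; true; false; _∧_; _∨_; not; if_then_else_)
open import Data.List using (List; []; _∷_; _++_; length; map; concatMap; upTo; reverse; replicate; concat; foldr)
open import Data.Nat.ListAction using (sum)
open import Data.List.Relation.Unary.All using (All)
open import Data.List.Relation.Unary.Linked using (Linked; []; [-]; _∷_)
open import Data.Vec using (Vec)
import Data.Vec as Vec
open import Data.Maybe using (Maybe; just; nothing)
open import Data.Product using (_×_; _,_)
open import Relation.Binary.PropositionalEquality using (_≡_; refl)

bfilter : {A : Set} → (A → Bool) → List A → List A
bfilter p [] = []
bfilter p (x ∷ xs) = if p x then x ∷ bfilter p xs else bfilter p xs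

ball : {A : Set} → (A → Bool) → List A → Bool
ball p [] = true
ball p (x ∷ xs) = p x ∧ ball p xs

bany : {A : Set} → (A → Bool) → List A → Bool
bany p [] = false
bany p (x ∷ xs) = p x ∨ bany p xs

mapMaybe : {A B : Set} → (A → Maybe B) → List A → List B
mapMaybe f [] = []
mapMaybe f (x ∷ xs) with f x
... | just y = y ∷ mapMaybe f xs
... | nothing = mapMaybe f xs

-- entry r of a list of naturals, 0 if out of range (rows of a partition)
get : List ℕ → ℕ → ℕ
get [] _ = 0
get (x ∷ xs) zero = x
get (x ∷ xs) (suc n) = get xs n

getRow : List (List ℕ) → ℕ → List ℕ
getRow [] _ = []
getRow (x ∷ xs) zero = x
getRow (x ∷ xs) (suc n) = getRow xs n

getM : List ℕ → ℕ → Maybe ℕ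
getM [] _ = nothing
getM (x ∷ xs) zero = just x
getM (x ∷ xs) (suc n) = getM xs n

setAt : List ℕ → ℕ → ℕ → List ℕ
setAt [] _ _ = []
setAt (x ∷ xs) zero v = v ∷ xs
setAt (x ∷ xs) (suc n) v = x ∷ setAt xs n v

count : ℕ → List ℕ → ℕ
count j w = length (bfilter (λ x → x ≡ᵇ j) w)

occurs : ℕ → List ℕ → Bool
occurs j w = bany (λ x → x ≡ᵇ j) w

maxL : List ℕ → ℕ
maxL = foldr _⊔_ 0

oneTo : ℕ → List ℕ
oneTo n = map suc (upTo n)

insertD : ℕ → List ℕ → List ℕ
insertD x [] = x ∷ []
insertD x (y ∷ ys) = if y ≤ᵇ x then x ∷ y ∷ ys else y ∷ insertD x ys

sortDesc : List ℕ → List ℕ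
sortDesc = foldr insertD []

eqList : List ℕ → List ℕ → Bool
eqList [] [] = true
eqList (x ∷ xs) (y ∷ ys) = (x ≡ᵇ y) ∧ eqList xs ys
eqList _ _ = false

IsPartition : List ℕ → Set
IsPartition λ' = All (λ x → 1 ≤ x) λ' × Linked (λ x y → y ≤ x) λ'

-- an m-partition is (a ; λ) with a ∈ ℕ^m and λ a partition
IsDominant : {m : ℕ} → Vec ℕ m → Set
IsDominant a = Linked (λ x y → y ≤ x) (Vec.toList a)

zeroDominant : (m : ℕ) → IsDominant (Vec.replicate m 0)
zeroDominant zero = []
zeroDominant (suc zero) = [-]
zeroDominant (suc (suc m)) = Data.Nat.z≤n ∷ zeroDominant (suc m)

mSize : {m : ℕ} → Vec ℕ m → List ℕ → ℕ
mSize a λ' = sum (Vec.toList a) + sum λ'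

-- returns (unmatched i positions reversed, unmatched i+1 positions reversed)
bracketAux : ℕ → ℕ → List ℕ → List ℕ → List ℕ → List ℕ × List ℕ
bracketAux i idx [] stack ui = ui , stack
bracketAux i idx (x ∷ w) stack ui =
  if x ≡ᵇ i
  then (matchOr stack)
  else (if x ≡ᵇ suc i then bracketAux i (suc idx) w (idx ∷ stack) ui
        else bracketAux i (suc idx) w stack ui)
  where
  matchOr : List ℕ → List ℕ × List ℕ
  matchOr [] = bracketAux i (suc idx) w [] (idx ∷ ui)
  matchOr (_ ∷ st) = bracketAux i (suc idx) w st ui

assign : List ℕ → ℕ → ℕ → ℕ → List ℕ → List ℕ
assign w i s k [] = w
assign w i s k (p ∷ ps) = assign (setAt w p (if k <ᵇ s then i else suc i)) i s (suc k) ps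

-- σ_i(w): unmatched letters i^r (i+1)^s are replaced by i^s (i+1)^r
sigma : ℕ → List ℕ → List ℕ
sigma i w with bracketAux i 0 w [] []
... | ui , st = assign w i (length st) 0 (reverse ui ++ reverse st)

-- bring a word to weakly decreasing evaluation by applying σ_i
-- at the first i with #i < #(i+1) (bubble sort on the evaluation)
firstAscent : List ℕ → List ℕ → Maybe ℕ
firstAscent w [] = nothing
firstAscent w (i ∷ is) = if count i w <ᵇ count (suc i) w then just i else firstAscent w is

dominantize : ℕ → List ℕ → List ℕ
dominantize zero w = w
dominantize (suc f) w with firstAscent w (oneTo (maxL w))
... | nothing = w
... | just i = dominantize f (sigma i w)

-- Charge (of a word of weakly decreasing evaluation); labeled letters
-- are overwritten by 0.

lastBelowAux : ℕ → ℕ → ℕ → List ℕ → Maybe ℕ → Maybe ℕ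
lastBelowAux j p i [] acc = acc
lastBelowAux j p i (x ∷ xs) acc =
  lastBelowAux j p (suc i) xs (if (x ≡ᵇ j) ∧ (i <ᵇ p) then just i else acc)

lastBelow : ℕ → ℕ → List ℕ → Maybe ℕ
lastBelow j p w = lastBelowAux j p 0 w nothing

-- number of consecutive letters j, j+1, ... with (unlabeled) occurrences
run : ℕ → List ℕ → ℕ → ℕ
run zero w j = 0
run (suc f) w j = if occurs j w then suc (run f w (suc j)) else 0

-- state: (current position, counter ℓ, word, sum of labels)
State : Set
State = ℕ × ℕ × List ℕ × ℕ

chargeStep : ℕ → State → State
chargeStep j (p , ℓ , w , acc) with lastBelow j p w
... | just q = q , ℓ , setAt w q 0 , acc + ℓ
... | nothing with lastBelow j (length w) w
...   | just q = q , suc ℓ , setAt w q 0 , acc + suc ℓ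
...   | nothing = p , ℓ , w , acc

passLoop : List ℕ → State → State
passLoop [] s = s
passLoop (j ∷ js) s = passLoop js (chargeStep j s)

chargeLoop : ℕ → List ℕ → ℕ
chargeLoop zero w = 0
chargeLoop (suc f) w with run (length w) w 1
... | zero = 0
... | suc k with passLoop (oneTo (suc k)) (length w , 0 , w , 0)
...   | _ , _ , w' , acc = acc + chargeLoop f w'

charge : List ℕ → ℕ
charge w = chargeLoop (suc (length w)) (dominantize (suc (maxL w * maxL w)) w)

-- Skew tableaux of shape ν/μ, rows as lists (row r occupies columns
-- μ_r+1 .. ν_r, columns 1-indexed, rows 0-indexed from the top)

allWords : ℕ → ℕ → List (List ℕ)
allWords m zero = [] ∷ []
allWords m (suc L) = concatMap (λ x → map (x ∷_) (allWords m L)) (oneTo m)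

allFillings : ℕ → List ℕ → List (List (List ℕ))
allFillings m [] = [] ∷ []
allFillings m (L ∷ Ls) = concatMap (λ row → map (row ∷_) (allFillings m Ls)) (allWords m L)

inShape : List ℕ → List ℕ → ℕ → ℕ → Bool
inShape ν μ r c = (get μ r <ᵇ c) ∧ (c ≤ᵇ get ν r)

entry : List ℕ → List ℕ → List (List ℕ) → ℕ → ℕ → Maybe ℕ
entry ν μ T r c = if inShape ν μ r c then getM (getRow T r) (c ∸ suc (get μ r)) else nothing

weakInc : List ℕ → Bool
weakInc [] = true
weakInc (x ∷ []) = true
weakInc (x ∷ y ∷ xs) = (x ≤ᵇ y) ∧ weakInc (y ∷ xs)

strictBelow : Maybe ℕ → Maybe ℕ → Bool
strictBelow (just x) (just y) = x <ᵇ y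
strictBelow _ _ = true

boundOK : List ℕ → ℕ → Maybe ℕ → Bool
boundOK a c (just i) = c ≤ᵇ get a (i ∸ 1)
boundOK a c nothing = true

-- The data of D_{ΛΩ}: Λ = (a;λ) dominant, Ω = (b;μ)

module _ (m : ℕ) (a : List ℕ) (lam : List ℕ) (b : List ℕ) (mu : List ℕ) where

  nu : List ℕ
  nu = sortDesc (a ++ lam)

  cells : List (ℕ × ℕ)
  cells = concatMap (λ r → map (λ c → r , c) (oneTo (get nu 0))) (upTo (length nu))

  shapeOK : Bool
  shapeOK = (length mu ≤ᵇ length nu) ∧ ball (λ r → get mu r ≤ᵇ get nu r) (upTo (length mu))

  isInS : List (List ℕ) → Bool
  isInS T =
    ball weakInc T
    ∧ ball (λ { (r , c) → strictBelow (entry nu mu T r c) (entry nu mu T (suc r) c) }) cells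
    ∧ ball (λ i → count i (concat T) ≡ᵇ get b (i ∸ 1)) (oneTo m)
    ∧ ball (λ { (r , c) → boundOK a c (entry nu mu T r c) }) cells

  S : List (List (List ℕ))
  S = if shapeOK
      then bfilter isInS (allFillings m (map (λ r → get nu r ∸ get mu r) (upTo (length nu))))
      else []

  colLetters : List (List ℕ) → ℕ → List ℕ
  colLetters T c = mapMaybe (λ r → entry nu mu T r c) (upTo (length nu))

  -- indices i (decreasing) of the letters ī in column c of T̄
  barLetters : List (List ℕ) → ℕ → List ℕ
  barLetters T c = bfilter (λ i → (c ≤ᵇ get a (i ∸ 1)) ∧ not (occurs i (colLetters T c))) (reverse (oneTo m))

  barRows : ℕ → List ℕ
  barRows c = bfilter (λ r → inShape mu lam r c) (upTo (length mu))

  barEntry : List (List ℕ) → ℕ → ℕ → Maybe ℕ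
  barEntry T r c = getM (barLetters T c) (length (bfilter (λ r' → r' <ᵇ r) (barRows c)))

  -- reading word of T̄ (rows bottom to top, left to right), with ī ↦ m+1−i
  wordBar : List (List ℕ) → List ℕ
  wordBar T = map (λ i → suc m ∸ i)
    (concatMap (λ r → mapMaybe (λ c → if inShape mu lam r c then barEntry T r c else nothing)
                               (oneTo (get mu r)))
               (reverse (upTo (length mu))))

  -- u_a = 2̄^{a1−a2} ⋯ m̄^{a1−am}, with ī ↦ m+1−i
  uA : List ℕ
  uA = concatMap (λ i → replicate (get a 0 ∸ get a (i ∸ 1)) (suc m ∸ i))
                 (bfilter (λ i → 2 ≤ᵇ i) (oneTo m))

  Inv : ℕ
  Inv = length (bfilter (λ { (i , j) → (i <ᵇ j) ∧ (get b i <ᵇ get b j) })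
                        (concatMap (λ i → map (λ j → i , j) (upTo m)) (upTo m)))

  chargeAB : List (List ℕ) → ℕ
  chargeAB T = Inv + charge (wordBar T ++ uA)

  -- coefficient of t^k in D_{ΛΩ}(t) = Σ_{T ∈ S_{ΛΩ}} t^{charge_{a,b}(T)}
  Dcoeff : ℕ → ℕ
  Dcoeff k = length (bfilter (λ T → chargeAB T ≡ᵇ k) S)

-- Elements of R_m are described by their coordinates in the basis
-- {k_Ω}; a coordinate lying in ℕ[t] is given as ℕ → ℕ (coefficient of t^k).

-- coordinate of s*_Λ (Λ = (a;λ) dominant) at k_Ω, coefficient of t^k
sStarCoeff : (m : ℕ) (a : Vec ℕ m) (lam : List ℕ) → IsDominant a →
             (b : Vec ℕ m) (mu : List ℕ) → ℕ → ℕ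
sStarCoeff m a lam _ b mu k =
  if mSize a lam ≡ᵇ mSize b mu
  then Dcoeff m (Vec.toList a) lam (Vec.toList b) mu k
  else 0

-- coordinate of k_Λ at k_Ω, coefficient of t^k (Kronecker delta)
kCoeff : (m : ℕ) (a : Vec ℕ m) (lam : List ℕ) (b : Vec ℕ m) (mu : List ℕ) → ℕ → ℕ
kCoeff m a lam b mu k =
  if eqList (Vec.toList a) (Vec.toList b) ∧ eqList lam mu ∧ (k ≡ᵇ 0) then 1 else 0

{-# OPTIONS --safe #-}
module Submission where

-- With non-symmetric part zero, a letter i of a tableau in S_{ΛΩ} may only occupy
-- columns 1, …, a_i = 0, so every tableau in S_{ΛΩ} is empty.  An empty tableau of
-- shape (0 ∪ λ)/μ exists only when μ = λ and b = 0, and then its charge is 0: Inv(0) = 0,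
-- μ/λ is empty and u_0 is the empty word.  Hence D_{ΛΩ}(t) = δ_{ΛΩ}, i.e. s*_Λ = k_Λ.

open import Defs
open import Data.Nat using (ℕ; zero; suc; _+_; _∸_; _≤_; _<_; _≡ᵇ_; _<ᵇ_; _≤ᵇ_; z≤n; s≤s)
open import Data.Nat.Properties
open import Data.Bool using (Bool; true; false; _∧_; if_then_else_)
open import Data.Bool.Properties using (∧-zeroʳ)
open import Data.List using (List; []; _∷_; _++_; length; map; concatMap; upTo; applyUpTo; concat; foldr; reverse)
  renaming (replicate to lreplicate)
open import Data.List.Properties using (foldr-++; ++-identityʳ; length-++; length-map; length-upTo; map-upTo; ≡-dec)
open import Data.List.Relation.Unary.All using (All; _∷_)
open import Data.List.Relation.Unary.Any using (here; there)
open import Data.List.Relation.Unary.Linked using (Linked; _∷_)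
open import Data.List.Membership.Propositional using (_∈_; find; lose)
open import Data.List.Membership.Propositional.Properties
  using (∈-concatMap⁺; ∈-concatMap⁻; ∈-map⁺; ∈-map⁻; ∈-upTo⁺)
open import Data.Maybe using (Maybe; just; nothing)
open import Data.Product using (_×_; _,_; proj₁; proj₂)
open import Data.Vec using (Vec; replicate)
import Data.Vec as Vec
import Data.Vec.Properties as Vec
open import Relation.Binary.PropositionalEquality
open import Relation.Nullary using (¬_; yes; no; _×-dec_)
open import Data.Empty using (⊥-elim)

open ≡-Reasoning

T⇒≡true : ∀ {b} → Data.Bool.T b → b ≡ true
T⇒≡true {true} _ = refl

≡true⇒T : ∀ {b} → b ≡ true → Data.Bool.T b
≡true⇒T refl = _

∧-true⁻ : ∀ {x y} → (x ∧ y) ≡ true → x ≡ true × y ≡ true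
∧-true⁻ {true} {true} _ = refl , refl

≡ᵇ-refl : ∀ n → (n ≡ᵇ n) ≡ true
≡ᵇ-refl n = T⇒≡true (≡⇒≡ᵇ n n refl)

module _ {A : Set} (p : A → Bool) where

  ball⁻ : ∀ {xs x} → ball p xs ≡ true → x ∈ xs → p x ≡ true
  ball⁻ {y ∷ ys} h (here refl) = proj₁ (∧-true⁻ {p y} h)
  ball⁻ {y ∷ ys} h (there x∈) = ball⁻ (proj₂ (∧-true⁻ {p y} h)) x∈

  ball⁺ : ∀ xs → (∀ x → x ∈ xs → p x ≡ true) → ball p xs ≡ true
  ball⁺ [] _ = refl
  ball⁺ (y ∷ ys) h rewrite h y (here refl) = ball⁺ ys (λ x x∈ → h x (there x∈))

  ∈-bfilter⁻ : ∀ xs {x} → x ∈ bfilter p xs → x ∈ xs × p x ≡ true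
  ∈-bfilter⁻ (y ∷ ys) x∈ with p y in py | x∈
  ... | true  | here refl = here refl , py
  ... | true  | there x∈′ = let x∈ys , px = ∈-bfilter⁻ ys x∈′ in there x∈ys , px
  ... | false | x∈′       = let x∈ys , px = ∈-bfilter⁻ ys x∈′ in there x∈ys , px

  bfilter-none : ∀ xs → (∀ x → x ∈ xs → p x ≡ false) → bfilter p xs ≡ []
  bfilter-none [] _ = refl
  bfilter-none (y ∷ ys) h rewrite h y (here refl) = bfilter-none ys (λ x x∈ → h x (there x∈))

mapMaybe-nothing : {A B : Set} (f : A → Maybe B) → (∀ x → f x ≡ nothing) → ∀ xs → mapMaybe f xs ≡ []
mapMaybe-nothing f h [] = refl
mapMaybe-nothing f h (y ∷ ys) with f y | h y
... | nothing | _ = mapMaybe-nothing f h ys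

ball-replicate : {A : Set} (p : A → Bool) (n : ℕ) {x : A} → p x ≡ true → ball p (lreplicate n x) ≡ true
ball-replicate p zero _ = refl
ball-replicate p (suc n) px rewrite px = ball-replicate p n px

concatMap-[] : {A B : Set} (f : A → List B) → ∀ xs → (∀ x → x ∈ xs → f x ≡ []) → concatMap f xs ≡ []
concatMap-[] f [] _ = refl
concatMap-[] f (y ∷ ys) h rewrite h y (here refl) = concatMap-[] f ys (λ x x∈ → h x (there x∈))

no-member⇒[] : {A : Set} (xs : List A) → (∀ {x} → ¬ x ∈ xs) → xs ≡ []
no-member⇒[] [] _ = refl
no-member⇒[] (x ∷ _) ∉ = ⊥-elim (∉ (here refl))

eqList⇒≡ : ∀ xs ys → eqList xs ys ≡ true → xs ≡ ys
eqList⇒≡ [] [] _ = refl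
eqList⇒≡ (x ∷ xs) (y ∷ ys) h =
  let x≡y , xs≡ys = ∧-true⁻ {x ≡ᵇ y} h in cong₂ _∷_ (≡ᵇ⇒≡ x y (≡true⇒T x≡y)) (eqList⇒≡ xs ys xs≡ys)

eqList-refl : ∀ xs → eqList xs xs ≡ true
eqList-refl [] = refl
eqList-refl (x ∷ xs) rewrite ≡ᵇ-refl x = eqList-refl xs

Decreasing : List ℕ → Set
Decreasing = Linked (λ x y → y ≤ x)

get-beyond : ∀ l {r} → length l ≤ r → get l r ≡ 0
get-beyond [] _ = refl
get-beyond (x ∷ l) (s≤s h) = get-beyond l h

get-replicate-0 : ∀ n r → get (lreplicate n 0) r ≡ 0
get-replicate-0 zero r = refl
get-replicate-0 (suc n) zero = refl
get-replicate-0 (suc n) (suc r) = get-replicate-0 n r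

get-++-replicate-0 : ∀ l n r → get (l ++ lreplicate n 0) r ≡ get l r
get-++-replicate-0 [] n r = get-replicate-0 n r
get-++-replicate-0 (x ∷ l) n zero = refl
get-++-replicate-0 (x ∷ l) n (suc r) = get-++-replicate-0 l n r

get-applyUpTo : ∀ (f : ℕ → ℕ) n {r} → r < n → get (applyUpTo f n) r ≡ f r
get-applyUpTo f (suc n) {zero} _ = refl
get-applyUpTo f (suc n) {suc r} (s≤s r<n) = get-applyUpTo (λ i → f (suc i)) n r<n

get-≤-head : ∀ l r → Decreasing l → get l r ≤ get l 0
get-≤-head [] r _ = z≤n
get-≤-head (x ∷ l) zero _ = ≤-refl
get-≤-head (x ∷ []) (suc r) _ = z≤n
get-≤-head (x ∷ y ∷ l) (suc r) (y≤x ∷ h) = ≤-trans (get-≤-head (y ∷ l) r h) y≤x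

get-injective-positive : ∀ xs ys → All (1 ≤_) xs → All (1 ≤_) ys → (∀ r → get xs r ≡ get ys r) → xs ≡ ys
get-injective-positive [] [] _ _ _ = refl
get-injective-positive [] (y ∷ ys) _ (s≤s _ ∷ _) h with h 0
... | ()
get-injective-positive (x ∷ xs) [] (s≤s _ ∷ _) _ h with h 0
... | ()
get-injective-positive (x ∷ xs) (y ∷ ys) (_ ∷ pxs) (_ ∷ pys) h =
  cong₂ _∷_ (h 0) (get-injective-positive xs ys pxs pys (λ r → h (suc r)))

applyUpTo-zero : ∀ (f : ℕ → ℕ) n → (∀ r → f r ≡ 0) → applyUpTo f n ≡ lreplicate n 0
applyUpTo-zero f zero _ = refl
applyUpTo-zero f (suc n) h = cong₂ _∷_ (h 0) (applyUpTo-zero (λ i → f (suc i)) n (λ r → h (suc r)))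

sortDesc-decreasing : ∀ l → Decreasing l → sortDesc l ≡ l
sortDesc-decreasing [] _ = refl
sortDesc-decreasing (x ∷ []) _ = refl
sortDesc-decreasing (x ∷ y ∷ ys) (y≤x ∷ h)
  rewrite sortDesc-decreasing (y ∷ ys) h | T⇒≡true (≤⇒≤ᵇ y≤x) = refl

insertD-0 : ∀ l n → All (1 ≤_) l → insertD 0 (l ++ lreplicate n 0) ≡ l ++ lreplicate (suc n) 0
insertD-0 [] zero _ = refl
insertD-0 [] (suc n) _ = refl
insertD-0 (suc x ∷ l) n (_ ∷ h) rewrite insertD-0 l n h = refl

insertD-0s : ∀ l n → All (1 ≤_) l → foldr insertD l (lreplicate n 0) ≡ l ++ lreplicate n 0
insertD-0s l zero _ = sym (++-identityʳ l)
insertD-0s l (suc n) h rewrite insertD-0s l n h = insertD-0 l n h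

sortDesc-0s-partition : ∀ n lam → IsPartition lam → sortDesc (lreplicate n 0 ++ lam) ≡ lam ++ lreplicate n 0
sortDesc-0s-partition n lam (positive , decreasing) = begin
  foldr insertD [] (lreplicate n 0 ++ lam)    ≡⟨ foldr-++ insertD [] (lreplicate n 0) lam ⟩
  foldr insertD (sortDesc lam) (lreplicate n 0) ≡⟨ cong (λ l → foldr insertD l (lreplicate n 0)) (sortDesc-decreasing lam decreasing) ⟩
  foldr insertD lam (lreplicate n 0)          ≡⟨ insertD-0s lam n positive ⟩
  lam ++ lreplicate n 0                       ∎

allWords-length : ∀ m L {w} → w ∈ allWords m L → length w ≡ L
allWords-length m zero (here refl) = refl
allWords-length m (suc L) w∈ with find (∈-concatMap⁻ (λ x → map (x ∷_) (allWords m L)) {xs = oneTo m} w∈)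
... | x , _ , w∈x∷ with ∈-map⁻ (x ∷_) w∈x∷
... | w′ , w′∈ , refl = cong suc (allWords-length m L w′∈)

allFillings-rowLength : ∀ m Ls {T} → T ∈ allFillings m Ls → ∀ r → length (getRow T r) ≡ get Ls r
allFillings-rowLength m [] (here refl) r = refl
allFillings-rowLength m (L ∷ Ls) T∈ r
  with find (∈-concatMap⁻ (λ row → map (row ∷_) (allFillings m Ls)) {xs = allWords m L} T∈)
... | row , row∈ , T∈row∷ with ∈-map⁻ (row ∷_) T∈row∷ | r
... | T′ , T′∈ , refl | zero = allWords-length m L row∈
... | T′ , T′∈ , refl | suc r′ = allFillings-rowLength m Ls T′∈ r′

allFillings-0s : ∀ m n → allFillings m (lreplicate n 0) ≡ lreplicate n [] ∷ []
allFillings-0s m zero = refl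
allFillings-0s m (suc n) rewrite allFillings-0s m n = refl

getRow-replicate-[] : ∀ n r → getRow (lreplicate n []) r ≡ []
getRow-replicate-[] zero r = refl
getRow-replicate-[] (suc n) zero = refl
getRow-replicate-[] (suc n) (suc r) = getRow-replicate-[] n r

concat-emptyRows : ∀ (T : List (List ℕ)) → (∀ r → getRow T r ≡ []) → concat T ≡ []
concat-emptyRows [] _ = refl
concat-emptyRows (row ∷ T) h rewrite h 0 = concat-emptyRows T (λ r → h (suc r))

entry-emptyRow : ∀ ν μ T r c → getRow T r ≡ [] → entry ν μ T r c ≡ nothing
entry-emptyRow ν μ T r c row≡[] with inShape ν μ r c
... | true rewrite row≡[] = refl
... | false = refl

entry-firstCell : ∀ ν μ T r {x xs} → getRow T r ≡ x ∷ xs → get μ r < get ν r →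
                  entry ν μ T r (suc (get μ r)) ≡ just x
entry-firstCell ν μ T r row≡ μ<ν
  rewrite T⇒≡true (<⇒<ᵇ (n<1+n (get μ r))) | T⇒≡true (≤⇒≤ᵇ μ<ν) | n∸n≡0 (get μ r) | row≡ = refl

inShape-diagonal : ∀ μ r c → inShape μ μ r c ≡ false
inShape-diagonal μ r c with get μ r <ᵇ c in lt | c ≤ᵇ get μ r in le
... | false | _ = refl
... | true | false = refl
... | true | true = ⊥-elim (<-irrefl refl (<-≤-trans (<ᵇ⇒< _ _ (≡true⇒T lt)) (≤ᵇ⇒≤ c _ (≡true⇒T le))))

module _ (m : ℕ) (a lam b mu : List ℕ) where

  private
    ν : List ℕ
    ν = nu m a lam b mu

    rowLengths : List ℕ
    rowLengths = map (λ r → get ν r ∸ get mu r) (upTo (length ν))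

  ∈-S⁻ : ∀ {T} → T ∈ S m a lam b mu →
         shapeOK m a lam b mu ≡ true × T ∈ allFillings m rowLengths × isInS m a lam b mu T ≡ true
  ∈-S⁻ T∈ with shapeOK m a lam b mu
  ... | true = let T∈F , inS = ∈-bfilter⁻ (isInS m a lam b mu) (allFillings m rowLengths) T∈ in refl , T∈F , inS

  rowLength : ∀ {T} → T ∈ allFillings m rowLengths → ∀ r → r < length ν → length (getRow T r) ≡ get ν r ∸ get mu r
  rowLength {T} T∈ r r<n = begin
    length (getRow T r)  ≡⟨ allFillings-rowLength m rowLengths T∈ r ⟩
    get rowLengths r     ≡⟨ cong (λ l → get l r) (map-upTo _ (length ν)) ⟩
    _                    ≡⟨ get-applyUpTo (λ r → get ν r ∸ get mu r) (length ν) r<n ⟩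
    get ν r ∸ get mu r   ∎

  rowLength-beyond : ∀ {T} → T ∈ allFillings m rowLengths → ∀ {r} → length ν ≤ r → length (getRow T r) ≡ 0
  rowLength-beyond T∈ {r} n≤r = trans (allFillings-rowLength m rowLengths T∈ r) (get-beyond rowLengths
    (subst (_≤ r) (sym (trans (length-map _ (upTo (length ν))) (length-upTo (length ν)))) n≤r))

  shapeOK⇒length : shapeOK m a lam b mu ≡ true → length mu ≤ length ν
  shapeOK⇒length sh = ≤ᵇ⇒≤ (length mu) (length ν) (≡true⇒T (proj₁ (∧-true⁻ {length mu ≤ᵇ length ν} sh)))

  shapeOK⇒contained : shapeOK m a lam b mu ≡ true → ∀ r → get mu r ≤ get ν r
  shapeOK⇒contained sh r with r <? length mu
  ... | yes r<l = ≤ᵇ⇒≤ (get mu r) (get ν r) (≡true⇒T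
        (ball⁻ (λ r → get mu r ≤ᵇ get ν r) (proj₂ (∧-true⁻ {length mu ≤ᵇ length ν} sh)) (∈-upTo⁺ r<l)))
  ... | no r≮l = subst (_≤ get ν r) (sym (get-beyond mu (≮⇒≥ r≮l))) z≤n

  private
    columnStrict : List (List ℕ) → ℕ × ℕ → Bool
    columnStrict T (r , c) = strictBelow (entry ν mu T r c) (entry ν mu T (suc r) c)

    hasContent : List (List ℕ) → ℕ → Bool
    hasContent T i = count i (concat T) ≡ᵇ get b (i ∸ 1)

    columnBound : List (List ℕ) → ℕ × ℕ → Bool
    columnBound T (r , c) = boundOK a c (entry ν mu T r c)

  isInS⇒content : ∀ {T} → isInS m a lam b mu T ≡ true → ∀ {i} → i ∈ oneTo m → count i (concat T) ≡ get b (i ∸ 1)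
  isInS⇒content {T} inS i∈ =
    let _ , inS′ = ∧-true⁻ {ball weakInc T} inS
        _ , inS″ = ∧-true⁻ {ball (columnStrict T) (cells m a lam b mu)} inS′
        content , _ = ∧-true⁻ {ball (hasContent T) (oneTo m)} inS″
    in ≡ᵇ⇒≡ _ _ (≡true⇒T (ball⁻ (hasContent T) content i∈))

  isInS⇒columnBound : ∀ {T} → isInS m a lam b mu T ≡ true → ∀ {r c} → (r , c) ∈ cells m a lam b mu →
                      boundOK a c (entry ν mu T r c) ≡ true
  isInS⇒columnBound {T} inS rc∈ =
    let _ , inS′ = ∧-true⁻ {ball weakInc T} inS
        _ , inS″ = ∧-true⁻ {ball (columnStrict T) (cells m a lam b mu)} inS′
        _ , bound = ∧-true⁻ {ball (hasContent T) (oneTo m)} inS″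
    in ball⁻ (columnBound T) bound rc∈

  isInS-emptyTableau : ∀ n → (∀ i → get b i ≡ 0) → isInS m a lam b mu (lreplicate n []) ≡ true
  isInS-emptyTableau n b≡0 =
    cong₂ _∧_ (ball-replicate weakInc n refl)
      (cong₂ _∧_ (ball⁺ (columnStrict E) (cells m a lam b mu) λ { (r , c) _ →
                    cong₂ strictBelow (entry-nothing r c) (entry-nothing (suc r) c) })
        (cong₂ _∧_ (ball⁺ (hasContent E) (oneTo m) λ i _ →
                      cong₂ (λ w k → count i w ≡ᵇ k) (concat-emptyRows E (getRow-replicate-[] n)) (b≡0 (i ∸ 1)))
          (ball⁺ (columnBound E) (cells m a lam b mu) λ { (r , c) _ → cong (boundOK a c) (entry-nothing r c) })))
    where
    E : List (List ℕ)
    E = lreplicate n []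
    entry-nothing : ∀ r c → entry ν mu E r c ≡ nothing
    entry-nothing r c = entry-emptyRow ν mu E r c (getRow-replicate-[] n r)

  ∈-cells : ∀ {r c} → r < length ν → c < get ν 0 → (r , suc c) ∈ cells m a lam b mu
  ∈-cells r<n c<ν₀ = ∈-concatMap⁺ (λ r → map (r ,_) (oneTo (get ν 0)))
    (lose (∈-upTo⁺ r<n) (∈-map⁺ _ (∈-map⁺ suc (∈-upTo⁺ c<ν₀))))

  S-emptyRows⇒sameShape : ∀ {T} → T ∈ S m a lam b mu → (∀ r → getRow T r ≡ []) → ∀ r → get mu r ≡ get ν r
  S-emptyRows⇒sameShape T∈ empty r with ∈-S⁻ T∈ | r <? length ν
  ... | sh , T∈F , _ | yes r<n = ≤-antisym (shapeOK⇒contained sh r)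
        (m∸n≡0⇒m≤n (trans (sym (rowLength T∈F r r<n)) (cong length (empty r))))
  ... | sh , _ , _ | no r≮n = trans (get-beyond mu (≤-trans (shapeOK⇒length sh) (≮⇒≥ r≮n)))
                                    (sym (get-beyond ν (≮⇒≥ r≮n)))

boundOK-0s : ∀ m c x → boundOK (lreplicate m 0) (suc c) (just x) ≡ false
boundOK-0s m c x rewrite get-replicate-0 m (x ∸ 1) = refl

module _ (m : ℕ) {lam : List ℕ} (lam-partition : IsPartition lam) (b mu : List ℕ) where

  private
    zeros : List ℕ
    zeros = lreplicate m 0

    ν : List ℕ
    ν = nu m zeros lam b mu

  nu-0s : ν ≡ lam ++ lreplicate m 0
  nu-0s = sortDesc-0s-partition m lam lam-partition

  get-nu-0s : ∀ r → get ν r ≡ get lam r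
  get-nu-0s r = trans (cong (λ l → get l r) nu-0s) (get-++-replicate-0 lam m r)

  S-0s⇒emptyRows : ∀ {T} → T ∈ S m zeros lam b mu → ∀ r → getRow T r ≡ []
  S-0s⇒emptyRows {T} T∈ r with ∈-S⁻ m zeros lam b mu T∈ | getRow T r in row≡
  ... | _ | [] = refl
  ... | _ , T∈F , inS | x ∷ xs with r <? length ν
  ...   | no r≮n = ⊥-elim (1+n≢0 (trans (cong length (sym row≡)) (rowLength-beyond m zeros lam b mu T∈F (≮⇒≥ r≮n))))
  ...   | yes r<n = ⊥-elim (false≢true (trans (sym (boundOK-0s m (get mu r) x)) letter-x-in-bounds))
    where
    μ<ν : get mu r < get ν r
    μ<ν = m∸n≢0⇒n<m λ ν∸μ≡0 → 1+n≢0 (trans (cong length (sym row≡)) (trans (rowLength m zeros lam b mu T∈F r r<n) ν∸μ≡0))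
    μ<ν₀ : get mu r < get ν 0
    μ<ν₀ = <-≤-trans μ<ν (subst₂ _≤_ (sym (get-nu-0s r)) (sym (get-nu-0s 0)) (get-≤-head lam r (proj₂ lam-partition)))
    letter-x-in-bounds : boundOK zeros (suc (get mu r)) (just x) ≡ true
    letter-x-in-bounds = subst (λ e → boundOK zeros (suc (get mu r)) e ≡ true)
      (entry-firstCell ν mu T r row≡ μ<ν) (isInS⇒columnBound m zeros lam b mu {T} inS (∈-cells m zeros lam b mu r<n μ<ν₀))
    false≢true : false ≢ true
    false≢true ()

  S-0s⇒diagonal : All (1 ≤_) mu → ∀ {T} → T ∈ S m zeros lam b mu → (∀ i → i < m → get b i ≡ 0) × mu ≡ lam
  S-0s⇒diagonal mu-positive {T} T∈ = b≡0 , mu≡lam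
    where
    empty : ∀ r → getRow T r ≡ []
    empty = S-0s⇒emptyRows T∈
    inS : isInS m zeros lam b mu T ≡ true
    inS = proj₂ (proj₂ (∈-S⁻ m zeros lam b mu T∈))
    b≡0 : ∀ i → i < m → get b i ≡ 0
    b≡0 i i<m = begin
      get b i                       ≡⟨ isInS⇒content m zeros lam b mu {T} inS (∈-map⁺ suc (∈-upTo⁺ i<m)) ⟨
      count (suc i) (concat T)      ≡⟨ cong (count (suc i)) (concat-emptyRows T empty) ⟩
      0                             ∎
    mu≡lam : mu ≡ lam
    mu≡lam = get-injective-positive mu lam mu-positive (proj₁ lam-partition)
      (λ r → trans (S-emptyRows⇒sameShape m zeros lam b mu T∈ empty r) (get-nu-0s r))

Inv-0s : ∀ m a lam mu → Inv m a lam (lreplicate m 0) mu ≡ 0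
Inv-0s m a lam mu = cong length (bfilter-none inversion (concatMap (λ i → map (i ,_) (upTo m)) (upTo m))
  λ { (i , j) _ → trans (cong₂ (λ x y → (i <ᵇ j) ∧ (x <ᵇ y)) (get-replicate-0 m i) (get-replicate-0 m j)) (∧-zeroʳ (i <ᵇ j)) })
  where
  inversion : ℕ × ℕ → Bool
  inversion (i , j) = (i <ᵇ j) ∧ (get (lreplicate m 0) i <ᵇ get (lreplicate m 0) j)

uA-0s : ∀ m lam b mu → uA m (lreplicate m 0) lam b mu ≡ []
uA-0s m lam b mu = concatMap-[] (λ i → lreplicate (get zeros 0 ∸ get zeros (i ∸ 1)) (suc m ∸ i))
                                (bfilter (2 ≤ᵇ_) (oneTo m)) λ i _ →
  cong (λ k → lreplicate k (suc m ∸ i)) (cong₂ _∸_ (get-replicate-0 m 0) (get-replicate-0 m (i ∸ 1)))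
  where
  zeros : List ℕ
  zeros = lreplicate m 0

wordBar-diagonal : ∀ m a lam b T → wordBar m a lam b lam T ≡ []
wordBar-diagonal m a lam b T = cong (map (suc m ∸_)) (concatMap-[] (λ r → mapMaybe (cellBar r) (oneTo (get lam r)))
  (reverse (upTo (length lam))) λ r _ →
  mapMaybe-nothing (cellBar r) (λ c → cong (λ s → if s then barEntry m a lam b lam T r c else nothing) (inShape-diagonal lam r c)) (oneTo (get lam r)))
  where
  cellBar : ℕ → ℕ → Maybe ℕ
  cellBar r c = if inShape lam lam r c then barEntry m a lam b lam T r c else nothing

chargeAB-0s-diagonal : ∀ m lam T → chargeAB m (lreplicate m 0) lam (lreplicate m 0) lam T ≡ 0
chargeAB-0s-diagonal m lam T = begin
  Inv m zeros lam zeros lam + charge (wordBar m zeros lam zeros lam T ++ uA m zeros lam zeros lam)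
    ≡⟨ cong₂ (λ i w → i + charge w) (Inv-0s m zeros lam lam)
             (cong₂ _++_ (wordBar-diagonal m zeros lam zeros T) (uA-0s m lam zeros lam)) ⟩
  0 + charge []
    ≡⟨⟩
  0 ∎
  where
  zeros : List ℕ
  zeros = lreplicate m 0

module _ (m : ℕ) {lam : List ℕ} (lam-partition : IsPartition lam) where

  private
    zeros : List ℕ
    zeros = lreplicate m 0

    ν : List ℕ
    ν = nu m zeros lam zeros lam

    emptyTableau : List (List ℕ)
    emptyTableau = lreplicate (length ν) []

  shapeOK-0s-diagonal : shapeOK m zeros lam zeros lam ≡ true
  shapeOK-0s-diagonal = cong₂ _∧_ (T⇒≡true (≤⇒≤ᵇ length-lam≤length-ν))
    (ball⁺ (λ r → get lam r ≤ᵇ get ν r) (upTo (length lam)) λ r _ →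
      T⇒≡true (≤⇒≤ᵇ (≤-reflexive (sym (get-nu-0s m lam-partition zeros lam r)))))
    where
    length-lam≤length-ν : length lam ≤ length ν
    length-lam≤length-ν = subst (length lam ≤_)
      (sym (trans (cong length (nu-0s m lam-partition zeros lam)) (length-++ lam))) (m≤m+n (length lam) _)

  rowLengths-0s-diagonal : map (λ r → get ν r ∸ get lam r) (upTo (length ν)) ≡ lreplicate (length ν) 0
  rowLengths-0s-diagonal = trans (map-upTo _ (length ν)) (applyUpTo-zero _ (length ν) λ r →
    trans (cong (_∸ get lam r) (get-nu-0s m lam-partition zeros lam r)) (n∸n≡0 (get lam r)))

  S-0s-diagonal : S m zeros lam zeros lam ≡ emptyTableau ∷ []
  S-0s-diagonal = begin
    S m zeros lam zeros lam
      ≡⟨ cong (λ ok → if ok then bfilter inS (allFillings m (map (λ r → get ν r ∸ get lam r) (upTo (length ν)))) else [])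
              shapeOK-0s-diagonal ⟩
    bfilter inS (allFillings m (map (λ r → get ν r ∸ get lam r) (upTo (length ν))))
      ≡⟨ cong (λ Ls → bfilter inS (allFillings m Ls)) rowLengths-0s-diagonal ⟩
    bfilter inS (allFillings m (lreplicate (length ν) 0))
      ≡⟨ cong (bfilter inS) (allFillings-0s m (length ν)) ⟩
    bfilter inS (emptyTableau ∷ [])
      ≡⟨ cong (λ ok → if ok then emptyTableau ∷ [] else [])
              (isInS-emptyTableau m zeros lam zeros lam (length ν) (get-replicate-0 m)) ⟩
    emptyTableau ∷ [] ∎
    where
    inS : List (List ℕ) → Bool
    inS = isInS m zeros lam zeros lam

  Dcoeff-0s-diagonal : ∀ k → Dcoeff m zeros lam zeros lam k ≡ (if k ≡ᵇ 0 then 1 else 0)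
  Dcoeff-0s-diagonal k = begin
    length (bfilter (λ T → chargeAB m zeros lam zeros lam T ≡ᵇ k) (S m zeros lam zeros lam))
      ≡⟨ cong (λ X → length (bfilter (λ T → chargeAB m zeros lam zeros lam T ≡ᵇ k) X)) S-0s-diagonal ⟩
    length (if chargeAB m zeros lam zeros lam emptyTableau ≡ᵇ k then emptyTableau ∷ [] else [])
      ≡⟨ cong (λ c → length (if c ≡ᵇ k then emptyTableau ∷ [] else [])) (chargeAB-0s-diagonal m lam emptyTableau) ⟩
    length (if 0 ≡ᵇ k then emptyTableau ∷ [] else [])
      ≡⟨ length-single-0 k ⟩
    (if k ≡ᵇ 0 then 1 else 0) ∎
    where
    length-single-0 : ∀ k → length (if 0 ≡ᵇ k then emptyTableau ∷ [] else []) ≡ (if k ≡ᵇ 0 then 1 else 0)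
    length-single-0 zero = refl
    length-single-0 (suc _) = refl

Dcoeff-0s-offDiagonal : ∀ m {lam} → IsPartition lam → ∀ b {mu} → All (1 ≤_) mu →
                        ¬ ((∀ i → i < m → get b i ≡ 0) × mu ≡ lam) → ∀ k → Dcoeff m (lreplicate m 0) lam b mu k ≡ 0
Dcoeff-0s-offDiagonal m {lam} lam-partition b {mu} mu-positive Ω≢Λ k =
  cong (λ X → length (bfilter (λ T → chargeAB m (lreplicate m 0) lam b mu T ≡ᵇ k) X))
       (no-member⇒[] _ λ T∈ → Ω≢Λ (S-0s⇒diagonal m lam-partition b mu mu-positive T∈))

Vec-get-0s : ∀ {m} (b : Vec ℕ m) → (∀ i → i < m → get (Vec.toList b) i ≡ 0) → b ≡ replicate m 0
Vec-get-0s Vec.[] _ = refl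
Vec-get-0s (x Vec.∷ b) h = cong₂ Vec._∷_ (h 0 (s≤s z≤n)) (Vec-get-0s b λ i i<m → h (suc i) (s≤s i<m))

if-then-0 : ∀ c {x : ℕ} → x ≡ 0 → (if c then x else 0) ≡ 0
if-then-0 true x≡0 = x≡0
if-then-0 false _ = refl

sStarCoeff-0s-diagonal : ∀ m {lam} → IsPartition lam → ∀ k →
  sStarCoeff m (replicate m 0) lam (zeroDominant m) (replicate m 0) lam k ≡ (if k ≡ᵇ 0 then 1 else 0)
sStarCoeff-0s-diagonal m {lam} lam-partition k
  rewrite ≡ᵇ-refl (mSize (replicate m 0) lam) | Vec.toList-replicate m 0 = Dcoeff-0s-diagonal m lam-partition k

sStarCoeff-0s-offDiagonal : ∀ m {lam} → IsPartition lam → ∀ b {mu} → All (1 ≤_) mu →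
  ¬ (b ≡ replicate m 0 × mu ≡ lam) → ∀ k → sStarCoeff m (replicate m 0) lam (zeroDominant m) b mu k ≡ 0
sStarCoeff-0s-offDiagonal m {lam} lam-partition b {mu} mu-positive Ω≢Λ k =
  if-then-0 (mSize (replicate m 0) lam ≡ᵇ mSize b mu) (begin
    Dcoeff m (Vec.toList (replicate m 0)) lam (Vec.toList b) mu k
      ≡⟨ cong (λ zeros → Dcoeff m zeros lam (Vec.toList b) mu k) (Vec.toList-replicate m 0) ⟩
    Dcoeff m (lreplicate m 0) lam (Vec.toList b) mu k
      ≡⟨ Dcoeff-0s-offDiagonal m lam-partition (Vec.toList b) mu-positive
           (λ (b≡0 , mu≡lam) → Ω≢Λ (Vec-get-0s b b≡0 , mu≡lam)) k ⟩
    0 ∎)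

kCoeff-diagonal : ∀ m a lam k → kCoeff m a lam a lam k ≡ (if k ≡ᵇ 0 then 1 else 0)
kCoeff-diagonal m a lam k rewrite eqList-refl (Vec.toList a) | eqList-refl lam = refl

kCoeff-offDiagonal : ∀ m a lam b mu k → ¬ (b ≡ a × mu ≡ lam) → kCoeff m a lam b mu k ≡ 0
kCoeff-offDiagonal m a lam b mu k Ω≢Λ with eqList (Vec.toList a) (Vec.toList b) in a≡b | eqList lam mu in lam≡mu
... | false | _ = refl
... | true | false = refl
... | true | true = ⊥-elim (Ω≢Λ (sym a≡b′ , sym (eqList⇒≡ lam mu lam≡mu)))
  where
  a≡b′ : a ≡ b
  a≡b′ = trans (sym (Vec.cast-is-id refl a)) (Vec.toList-injective refl a b (eqList⇒≡ _ _ a≡b))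

proposition7p6 : (m : ℕ) → 1 ≤ m → (lam : List ℕ) → IsPartition lam →
    (b : Vec ℕ m) (mu : List ℕ) → IsPartition mu → (k : ℕ) →
    sStarCoeff m (replicate m 0) lam (zeroDominant m) b mu k ≡ kCoeff m (replicate m 0) lam b mu k
proposition7p6 m _ lam lam-partition b mu mu-partition k
  with Vec.≡-dec _≟_ b (replicate m 0) ×-dec ≡-dec _≟_ mu lam
... | yes (refl , refl) =
  trans (sStarCoeff-0s-diagonal m lam-partition k) (sym (kCoeff-diagonal m (replicate m 0) lam k))
... | no Ω≢Λ =
  trans (sStarCoeff-0s-offDiagonal m lam-partition b (proj₁ mu-partition) Ω≢Λ k)
        (sym (kCoeff-offDiagonal m (replicate m 0) lam b mu k Ω≢Λ))
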